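{- Let $A$ and $B$ be two asynchronously composable IOTSes such that at least one of the following conditions holds: (1) $A\otimes_{as}B$ satisfies property $\mathcal{P}$; (2) $A\otimes_{as}B$ is half-duplex; (3) for each $(s_A,s_B)\in\mathit{reach}(A\otimes B)$ and all transitions $s_A\xrightarrow{a}_A s_A'$, $s_B\xrightarrow{b}_B s_B'$, either $a\notin\mathit{out}_A\cap\mathit{in}_B$ or $b\notin\mathit{out}_B\cap\mathit{in}_A$. Then: (1) if $A$ and $B$ are strongly synchronously compatible, then $A$ and $B$ are strongly asynchronously compatible; (2) if $A$ and $B$ are weakly synchronously compatible, then $A$ and $B$ are weakly asynchronously compatible.
   Context: An I/O-transition system (IOTS) is a quadruple $A=(\mathit{states}_A,\mathit{start}_A,\mathit{act}_A,\to_A)$ with a set of states, an initial state, a set of actions $\mathit{act}_A=\mathit{in}_A\cup\mathit{out}_A\cup\mathit{int}_A$ (disjoint union of input, output and internal actions), and a transition relation $\to_A\subseteq\mathit{states}_A\times\mathit{act}_A\times\mathit{states}_A$; write $s\xrightarrow{a}_A s'$. For $X\subseteq\mathit{act}_A$, $s\ (\xrightarrow{X})^*_A\ s'$ means a (possibly empty) finite sequence of transitions from $s$ to $s'$ labelled by actions in $X$. $\mathit{reach}(A)$ is the set of states reachable from $\mathit{start}_A$. $A,B$ are composable if $\mathit{act}_A\cap\mathit{act}_B=(\mathit{in}_A\cap\mathit{out}_B)\cup(\mathit{in}_B\cap\mathit{out}_A)=:\mathit{shared}(A,B)$. The synchronous composition $A\otimes B$ has states $\mathit{states}_A\times\mathit{states}_B$,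 initial state $(\mathit{start}_A,\mathit{start}_B)$, inputs $(\mathit{in}_A\cup\mathit{in}_B)\setminus\mathit{shared}(A,B)$, outputs $(\mathit{out}_A\cup\mathit{out}_B)\setminus\mathit{shared}(A,B)$, internal actions $\mathit{int}_A\cup\mathit{int}_B\cup\mathit{shared}(A,B)$; its transitions: a non-shared action of $A$ (resp. $B$) moves only the $A$ (resp. $B$) component according to a transition of $A$ (resp. $B$); a shared action $a$ gives $(s,t)\xrightarrow{a}(s',t')$ when $s\xrightarrow{a}_A s'$ and $t\xrightarrow{a}_B t'$. For a set $M$ let $M^\rhd=\{a^\rhd\mid a\in M\}$ (fresh names). The queue IOTS $Q_M$ has states $M^*$, initial state $\epsilon$, inputs $M^\rhd$, outputs $M$, no internal actions, transitions $q\xrightarrow{a^\rhd}qa$ and $aq\xrightarrow{a}q$. For $M\subseteq\mathit{out}_A$ with $M^\rhd\cap\mathit{act}_A=\emptyset$, $A^\rhd_M$ is $A$ with each $a\in M$ renamed to $a^\rhd$, and $\Omega_M(A)=A^\rhd_M\otimes Q_M$. $A,B$ are asynchronously composable if composable and $\mathit{shared}(A,B)^\rhd\cap(\mathit{act}_A\cup\mathit{act}_B)=\emptyset$. Let $\mathit{out}_{AB}=\mathit{out}_A\cap\mathit{in}_B$, $\mathit{out}_{BA}=\mathit{out}_B\cap\mathit{in}_A$, $\Omega(A)=\Omega_{\mathit{out}_{AB}}(A)$, $\Omega(B)=\Omega_{\mathit{out}_{BA}}(B)$. $\Omega(A)$ has states $(s,q)$, $q\in\mathit{out}_{AB}^*$,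 inputs $\mathit{in}_A$, outputs $\mathit{out}_A$, internal actions $\mathit{int}_A\cup\mathit{out}_{AB}^\rhd$, transitions $(s,q)\xrightarrow{a}(s',q)$ if $s\xrightarrow{a}_A s'$, $a\notin\mathit{out}_{AB}$; $(s,q)\xrightarrow{a^\rhd}(s',qa)$ if $s\xrightarrow{a}_A s'$, $a\in\mathit{out}_{AB}$; $(s,aq)\xrightarrow{a}(s,q)$ for $a\in\mathit{out}_{AB}$. $\Omega(B)$ analogously. $A\otimes_{as}B=\Omega(A)\otimes\Omega(B)$, initial state $((\mathit{start}_A,\epsilon),(\mathit{start}_B,\epsilon))$. Compatibility: $A,B$ are strongly synchronously compatible if composable and for every $(s_A,s_B)\in\mathit{reach}(A\otimes B)$: for every $a\in\mathit{out}_A\cap\mathit{in}_B$, if $s_A\xrightarrow{a}_A s_A'$ for some $s_A'$ then $s_B\xrightarrow{a}_B s_B'$ for some $s_B'$; and symmetrically for $b\in\mathit{out}_B\cap\mathit{in}_A$ with roles of $A,B$ exchanged. They are weakly synchronously compatible if composable and for every reachable $(s_A,s_B)$ and $a\in\mathit{out}_A\cap\mathit{in}_B$ with $s_A\xrightarrow{a}_A s_A'$ there exist $\bar s_B,s_B'$ with $s_B\ (\xrightarrow{\mathit{int}_B})^*_B\ \bar s_B\xrightarrow{a}_B s_B'$, and symmetrically (using $\mathit{int}_A$). Asynchronously composable $A,B$ are strongly (weakly) asynchronously compatible if $\Omega(A)$ and $\Omega(B)$ are strongly (weakly) synchronously compatible. $A\otimes_{as}B$ is half-duplex if every reachable state $((s_A,q_A),(s_B,q_B))$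 of $\Omega(A)\otimes\Omega(B)$ has $q_A=\epsilon$ or $q_B=\epsilon$. Property $\mathcal{P}$: with $F_A=\mathit{act}_A\setminus\mathit{shared}(A,B)$, for $a\in\mathit{out}_A\cap\mathit{in}_B$ write $s\Rightarrow^a_A s'$ if $s\ (\xrightarrow{F_A})^*_A\ \bar s\xrightarrow{a}_A\bar s'\ (\xrightarrow{F_A})^*_A\ s'$ for some $\bar s,\bar s'$; $\Rightarrow^b_B$ analogously. $A\otimes_{as}B$ satisfies $\mathcal{P}$ if every reachable state $((s_A,q_A),(s_B,q_B))$ of $\Omega(A)\otimes\Omega(B)$ satisfies one of: (i) $q_A=q_B=\epsilon$ and $(s_A,s_B)\in\mathit{reach}(A\otimes B)$; (ii) $q_A=a_1\ldots a_m\neq\epsilon$, $q_B=\epsilon$, and some $r_A$ has $(r_A,s_B)\in\mathit{reach}(A\otimes B)$ and $r_A\Rightarrow^{a_1}_A\cdots\Rightarrow^{a_m}_A s_A$; (iii) symmetric with $q_A=\epsilon$, $q_B=b_1\ldots b_m\neq\epsilon$, some $r_B$ with $(s_A,r_B)\in\mathit{reach}(A\otimes B)$ and $r_B\Rightarrow^{b_1}_B\cdots\Rightarrow^{b_m}_B s_B$. -}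

module Defs where

open import Data.Empty using (⊥)
open import Data.Product using (Σ; ∃; _×_; _,_; proj₁; proj₂)
open import Data.Sum using (_⊎_; inj₁; inj₂)
open import Data.List using (List; []; _∷_; _++_; [_])
open import Relation.Nullary using (¬_)
open import Relation.Binary.PropositionalEquality using (_≡_)
open import Relation.Binary.Construct.Closure.ReflexiveTransitive using (Star)

-- The side conditions of the definition (disjoint
-- in/out/int, transitions labelled by actions of A) are the separate
-- predicate WellFormed.

record IOTS (L : Set) : Set₁ where
  field
    State : Set
    start : State
    In    : L → Set
    Out   : L → Set
    Int   : L → Set
    _⟶[_]_ : State → L → State → Set

open IOTS public

module _ {L : Set} where

  Act : IOTS L → L → Set
  Act A a = In A a ⊎ Out A a ⊎ Int A a

  record WellFormed (A : IOTS L) : Set where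
    field
      in-out  : ∀ a → In A a → Out A a → ⊥
      in-int  : ∀ a → In A a → Int A a → ⊥
      out-int : ∀ a → Out A a → Int A a → ⊥
      trans-act : ∀ s a s' → (A ⟶[ s ] a) s' → Act A a

  StepIn : (A : IOTS L) → (L → Set) → State A → State A → Set
  StepIn A X s s' = Σ L λ a → X a × (A ⟶[ s ] a) s'

  Steps : (A : IOTS L) → (L → Set) → State A → State A → Set
  Steps A X = Star (StepIn A X)

  Reach : (A : IOTS L) → State A → Set
  Reach A s = Star (λ x y → Σ L λ a → (A ⟶[ x ] a) y) (start A) s

  Shared : IOTS L → IOTS L → L → Set
  Shared A B a = (In A a × Out B a) ⊎ (In B a × Out A a)

  -- act_A ∩ act_B = shared(A,B)  (⊇ holds by definition of Shared)
  Composable : IOTS L → IOTS L → Set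
  Composable A B = ∀ a → Act A a → Act B a → Shared A B a

  data ⊗Step (A B : IOTS L) : State A × State B → L → State A × State B → Set where
    stepA : ∀ {s s' t a} → ¬ Shared A B a → (A ⟶[ s ] a) s' →
            ⊗Step A B (s , t) a (s' , t)
    stepB : ∀ {s t t' a} → ¬ Shared A B a → (B ⟶[ t ] a) t' →
            ⊗Step A B (s , t) a (s , t')
    sync  : ∀ {s s' t t' a} → Shared A B a → (A ⟶[ s ] a) s' → (B ⟶[ t ] a) t' →
            ⊗Step A B (s , t) a (s' , t')

  _⊗_ : IOTS L → IOTS L → IOTS L
  A ⊗ B = record
    { State = State A × State B
    ; start = (start A , start B)
    ; In    = λ a → (In A a ⊎ In B a) × ¬ Shared A B a
    ; Out   = λ a → (Out A a ⊎ Out B a) × ¬ Shared A B a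
    ; Int   = λ a → Int A a ⊎ Int B a ⊎ Shared A B a
    ; _⟶[_]_ = ⊗Step A B
    }

  -- Renaming, queues, Ω.  _▷ : L → L produces the fresh names a^▷.

  module Async (_▷ : L → L) where

    data QStep (M : L → Set) : List L → L → List L → Set where
      enq : ∀ {q a} → M a → QStep M q (a ▷) (q ++ [ a ])
      deq : ∀ {q a} → M a → QStep M (a ∷ q) a q

    -- Queue IOTS Q_M (states: words over L; only words over M are reachable)
    Queue : (L → Set) → IOTS L
    Queue M = record
      { State = List L
      ; start = []
      ; In    = λ b → Σ L λ a → M a × b ≡ a ▷
      ; Out   = M
      ; Int   = λ _ → ⊥
      ; _⟶[_]_ = QStep M
      }

    data RenStep (A : IOTS L) (M : L → Set) : State A → L → State A → Set where
      keep : ∀ {s a s'} → ¬ M a → (A ⟶[ s ] a) s' → RenStep A M s a s'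
      ren  : ∀ {s a s'} → M a → (A ⟶[ s ] a) s' → RenStep A M s (a ▷) s'

    Rename : IOTS L → (L → Set) → IOTS L
    Rename A M = record
      { State = State A
      ; start = start A
      ; In    = λ b → In A b × ¬ M b
      ; Out   = λ b → (Out A b × ¬ M b) ⊎ (Σ L λ a → M a × b ≡ a ▷)
      ; Int   = λ b → Int A b × ¬ M b
      ; _⟶[_]_ = RenStep A M
      }

    Ω_ : (L → Set) → IOTS L → IOTS L
    Ω_ M A = Rename A M ⊗ Queue M

    OutAB : IOTS L → IOTS L → L → Set
    OutAB A B a = Out A a × In B a

    ΩA : IOTS L → IOTS L → IOTS L
    ΩA A B = Ω_ (OutAB A B) A

    _⊗as_ : IOTS L → IOTS L → IOTS L
    A ⊗as B = ΩA A B ⊗ ΩA B A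

    AsyncComposable : IOTS L → IOTS L → Set
    AsyncComposable A B =
      Composable A B ×
      (∀ a → Shared A B a → ¬ Act A (a ▷) × ¬ Act B (a ▷))

  StrongSyncCompatible : IOTS L → IOTS L → Set
  StrongSyncCompatible A B =
    Composable A B ×
    (∀ sA sB → Reach (A ⊗ B) (sA , sB) →
      (∀ a sA' → Out A a → In B a → (A ⟶[ sA ] a) sA' →
         Σ (State B) λ sB' → (B ⟶[ sB ] a) sB') ×
      (∀ b sB' → Out B b → In A b → (B ⟶[ sB ] b) sB' →
         Σ (State A) λ sA' → (A ⟶[ sA ] b) sA'))

  WeakSyncCompatible : IOTS L → IOTS L → Set
  WeakSyncCompatible A B =
    Composable A B ×
    (∀ sA sB → Reach (A ⊗ B) (sA , sB) →
      (∀ a sA' → Out A a → In B a → (A ⟶[ sA ] a) sA' →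
         Σ (State B) λ s̄B → Σ (State B) λ sB' →
           Steps B (Int B) sB s̄B × (B ⟶[ s̄B ] a) sB') ×
      (∀ b sB' → Out B b → In A b → (B ⟶[ sB ] b) sB' →
         Σ (State A) λ s̄A → Σ (State A) λ sA' →
           Steps A (Int A) sA s̄A × (A ⟶[ s̄A ] b) sA'))

  NoMixedSends : IOTS L → IOTS L → Set
  NoMixedSends A B =
    ∀ sA sB → Reach (A ⊗ B) (sA , sB) →
      ∀ a sA' b sB' → (A ⟶[ sA ] a) sA' → (B ⟶[ sB ] b) sB' →
        ¬ (Out A a × In B a) ⊎ ¬ (Out B b × In A b)

  module AsyncProps (_▷ : L → L) where
    open Async _▷

    StrongAsyncCompatible : IOTS L → IOTS L → Set
    StrongAsyncCompatible A B = StrongSyncCompatible (ΩA A B) (ΩA B A)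

    WeakAsyncCompatible : IOTS L → IOTS L → Set
    WeakAsyncCompatible A B = WeakSyncCompatible (ΩA A B) (ΩA B A)

    HalfDuplex : IOTS L → IOTS L → Set
    HalfDuplex A B =
      ∀ sA qA sB qB → Reach (A ⊗as B) ((sA , qA) , (sB , qB)) →
        qA ≡ [] ⊎ qB ≡ []

    F : IOTS L → IOTS L → L → Set
    F A B a = Act A a × ¬ Shared A B a

    WeakStep : (A B : IOTS L) → L → State A → State A → Set
    WeakStep A B a s s' =
      Σ (State A) λ s̄ → Σ (State A) λ s̄' →
        Steps A (F A B) s s̄ × (A ⟶[ s̄ ] a) s̄' × Steps A (F A B) s̄' s'

    data Chain (A B : IOTS L) : State A → List L → State A → Set where
      []  : ∀ {s} → Chain A B s [] s
      _∷_ : ∀ {s s₁ s₂ a as} → WeakStep A B a s s₁ → Chain A B s₁ as s₂ →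
            Chain A B s (a ∷ as) s₂

    PropertyP : IOTS L → IOTS L → Set
    PropertyP A B =
      ∀ sA qA sB qB → Reach (A ⊗as B) ((sA , qA) , (sB , qB)) →
        (qA ≡ [] × qB ≡ [] × Reach (A ⊗ B) (sA , sB))
        ⊎ (¬ qA ≡ [] × qB ≡ [] ×
           Σ (State A) λ rA → Reach (A ⊗ B) (rA , sB) × Chain A B rA qA sA)
        ⊎ (qA ≡ [] × ¬ qB ≡ [] ×
           Σ (State B) λ rB → Reach (A ⊗ B) (sA , rB) × Chain B A rB qB sB)

-- Every reachable state of the asynchronous composition is one-sided: one
-- queue is empty, and the component owning the other queue has merely run
-- ahead of a synchronous run, performing exactly the queued sends (and
-- unshared moves) while its partner stood still.  Under 𝒫 this is the
-- hypothesis; under half-duplex or no mixed sends it is an invariant, since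
-- the only dangerous move — a send by the component that is behind while the
-- other one has pending messages — would make both queues nonempty, or would
-- be a mixed send at a synchronously reachable state.  So the message at the
-- head of a queue was sent in a synchronously reachable state whose partner
-- component is the current one, and synchronous compatibility yields the
-- receive there, which the partner's Ω performs without touching its queue.
module Submission where

open import Defs
open import Data.Product using (_×_)
open import Data.Sum using (_⊎_)
open import Relation.Binary.PropositionalEquality using (_≡_)
open import Function.Definitions using (Injective)

open import Data.Empty using (⊥; ⊥-elim)
open import Data.Product using (Σ; ∃₂; _,_; proj₁; proj₂) renaming (swap to ×-swap)
open import Data.Sum using (inj₁; inj₂; [_,_]′) renaming (swap to ⊎-swap)
open import Data.List using (List; []; _∷_; _++_; [_])
open import Data.List.Properties using (++-conicalʳ)
open import Data.List.Relation.Unary.All using (All; []; _∷_)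
open import Data.List.Relation.Unary.All.Properties using (∷ʳ⁺)
open import Function using (_∘_)
open import Relation.Nullary using (¬_)
open import Relation.Binary.PropositionalEquality using (refl)
open import Relation.Binary.Construct.Closure.ReflexiveTransitive using (Star; ε; _◅_; _◅◅_; gmap)

snoc : ∀ {I : Set} {T : I → I → Set} {i j k} → Star T i j → T j k → Star T i k
snoc xs x = xs ◅◅ (x ◅ ε)

module _ {L : Set} (_▷ : L → L) where
  open Async _▷
  open AsyncProps _▷

  Step : (Z : IOTS L) → State Z → State Z → Set
  Step Z s s' = Σ L λ a → (Z ⟶[ s ] a) s'

  Reach-invariant : (Z : IOTS L) (P : State Z → Set) → P (start Z) →
    (∀ {s a s'} → Reach Z s → P s → (Z ⟶[ s ] a) s' → P s') →
    ∀ {s} → Reach Z s → P s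
  Reach-invariant Z P p₀ step = go ε p₀
    where
    go : ∀ {s s'} → Reach Z s → P s → Star (Step Z) s s' → P s'
    go r p ε = p
    go r p ((a , t) ◅ ts) = go (snoc r (a , t)) (step r p t) ts

  ⊗Step-swap : ∀ {X Y : IOTS L} {p a p'} → ⊗Step X Y p a p' → ⊗Step Y X (×-swap p) a (×-swap p')
  ⊗Step-swap (stepA ¬sh t) = stepB (¬sh ∘ ⊎-swap) t
  ⊗Step-swap (stepB ¬sh t) = stepA (¬sh ∘ ⊎-swap) t
  ⊗Step-swap (sync sh t u) = sync (⊎-swap sh) u t

  Reach-swap : ∀ {X Y : IOTS L} {p} → Reach (X ⊗ Y) p → Reach (Y ⊗ X) (×-swap p)
  Reach-swap = gmap ×-swap (λ (a , t) → a , ⊗Step-swap t)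

  F-steps⇒⊗ : ∀ {X Y : IOTS L} {s s' t} → Steps X (F X Y) s s' → Star (Step (X ⊗ Y)) (s , t) (s' , t)
  F-steps⇒⊗ {t = t} = gmap (_, t) (λ (a , (_ , ¬sh) , u) → a , stepA ¬sh u)

  Chain-extend : ∀ {X Y : IOTS L} {r a q s s'} → Chain X Y r (a ∷ q) s → StepIn X (F X Y) s s' →
    Chain X Y r (a ∷ q) s'
  Chain-extend ((s̄ , s̄' , pre , t , post) ∷ []) u = (s̄ , s̄' , pre , t , snoc post u) ∷ []
  Chain-extend (w ∷ w' ∷ ws) u = w ∷ Chain-extend (w' ∷ ws) u

  Chain-snoc : ∀ {X Y : IOTS L} {r q s a s'} → Chain X Y r q s → (X ⟶[ s ] a) s' →
    Chain X Y r (q ++ [ a ]) s'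
  Chain-snoc [] t = (_ , _ , ε , t , ε) ∷ []
  Chain-snoc (w ∷ ws) t = w ∷ Chain-snoc ws t

  -- Clause (ii) of 𝒫 without the condition on Y's queue.
  record Ahead (X Y : IOTS L) (sX : State X) (qX : List L) (sY : State Y) : Set where
    constructor ahead
    field
      {origin} : State X
      origin-reach : Reach (X ⊗ Y) (origin , sY)
      replay : Chain X Y origin qX sX

  OneSided : (X Y : IOTS L) → State X → List L → State Y → List L → Set
  OneSided X Y sX qX sY qY = (qY ≡ [] × Ahead X Y sX qX sY) ⊎ (qX ≡ [] × Ahead Y X sY qY sX)

  Ahead-head : ∀ {X Y : IOTS L} {sX a q sY} → Ahead X Y sX (a ∷ q) sY →
    ∃₂ λ s̄ s̄' → Reach (X ⊗ Y) (s̄ , sY) × (X ⟶[ s̄ ] a) s̄'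
  Ahead-head (ahead r ((s̄ , s̄' , pre , t , _) ∷ _)) = s̄ , s̄' , r ◅◅ F-steps⇒⊗ pre , t

  Ahead-local : ∀ {X Y : IOTS L} {sX qX sY c sX'} → Ahead X Y sX qX sY → (X ⟶[ sX ] c) sX' →
    F X Y c → Ahead X Y sX' qX sY
  Ahead-local (ahead r []) t (_ , ¬sh) = ahead (snoc r (_ , stepA ¬sh t)) []
  Ahead-local (ahead r (w ∷ ws)) t f = ahead r (Chain-extend (w ∷ ws) (_ , f , t))

  Ahead-send : ∀ {X Y : IOTS L} {sX qX sY x sX'} → Ahead X Y sX qX sY → (X ⟶[ sX ] x) sX' →
    Ahead X Y sX' (qX ++ [ x ]) sY
  Ahead-send (ahead r ws) t = ahead r (Chain-snoc ws t)

  Ahead-partner-local : ∀ {X Y : IOTS L} {sX qX sY c sY'} → Ahead X Y sX qX sY → (Y ⟶[ sY ] c) sY' →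
    ¬ Shared X Y c → Ahead X Y sX qX sY'
  Ahead-partner-local (ahead r ws) t ¬sh = ahead (snoc r (_ , stepB ¬sh t)) ws

  Ahead-partner-receive : ∀ {X Y : IOTS L} {sX c q sY sY'} → Ahead X Y sX (c ∷ q) sY →
    OutAB X Y c → (Y ⟶[ sY ] c) sY' → Ahead X Y sX q sY'
  Ahead-partner-receive (ahead r ((_ , _ , pre , t , post) ∷ ws)) (o , i) u =
    ahead (r ◅◅ F-steps⇒⊗ pre ◅◅ (_ , sync (inj₂ (i , o)) t u) ◅ F-steps⇒⊗ post) ws

  -- The common consequence of half-duplex and of no mixed sends.
  NoCrossing : (X Y : IOTS L) → State X → List L → Set
  NoCrossing X Y sX qY = ¬ qY ≡ [] →
    ∀ {x sX' b s̄Y s̄Y'} → Reach (X ⊗ Y) (sX , s̄Y) → (Y ⟶[ s̄Y ] b) s̄Y' → OutAB Y X b →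
    (X ⟶[ sX ] x) sX' → OutAB X Y x → ⊥

  Ahead-switch : ∀ {X Y : IOTS L} {sX sY qY x sX'} → NoCrossing X Y sX qY → All (OutAB Y X) qY →
    Ahead Y X sY qY sX → OutAB X Y x → (X ⟶[ sX ] x) sX' → qY ≡ [] × Ahead X Y sX' [ x ] sY
  Ahead-switch _ [] (ahead r []) _ u = refl , ahead (Reach-swap r) (Chain-snoc [] u)
  Ahead-switch blocked (n ∷ _) a m u =
    let _ , _ , r , t = Ahead-head a in ⊥-elim (blocked (λ ()) (Reach-swap r) t n u m)

  StrongSide : (X Y : IOTS L) → State X → State Y → Set
  StrongSide X Y sX sY = ∀ a sX' → Out X a → In Y a → (X ⟶[ sX ] a) sX' →
    Σ (State Y) λ sY' → (Y ⟶[ sY ] a) sY'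

  WeakSide : (X Y : IOTS L) → State X → State Y → Set
  WeakSide X Y sX sY = ∀ a sX' → Out X a → In Y a → (X ⟶[ sX ] a) sX' →
    Σ (State Y) λ s̄Y → Σ (State Y) λ sY' → Steps Y (Int Y) sY s̄Y × (Y ⟶[ s̄Y ] a) sY'

  module Queued (▷-injective : Injective _≡_ _≡_ _▷) (X : IOTS L) (wf : WellFormed X)
                (M : L → Set) (M⊆Out : ∀ {a} → M a → Out X a) (fresh : ∀ {a} → M a → ¬ Act X (a ▷)) where
    open WellFormed wf

    ΩM : IOTS L
    ΩM = Ω_ M X

    renamed-shared : ∀ {a} → M a → Shared (Rename X M) (Queue M) (a ▷)
    renamed-shared m = inj₂ ((_ , m , refl) , inj₂ (_ , m , refl))

    ¬Shared-RQ : ∀ {c} → Act X c → ¬ Shared (Rename X M) (Queue M) c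
    ¬Shared-RQ _ (inj₁ ((_ , ¬m) , m)) = ¬m m
    ¬Shared-RQ act (inj₂ ((_ , m , refl) , _)) = fresh m act

    In-Ω : ∀ {c} → In ΩM c → In X c × ¬ M c
    In-Ω (inj₁ i , _) = i
    In-Ω (inj₂ (_ , m , refl) , ¬sh) = ⊥-elim (¬sh (renamed-shared m))

    Out-Ω : ∀ {c} → Out ΩM c → Out X c
    Out-Ω (inj₁ (inj₁ (o , _)) , _) = o
    Out-Ω (inj₁ (inj₂ (_ , m , refl)) , ¬sh) = ⊥-elim (¬sh (renamed-shared m))
    Out-Ω (inj₂ m , _) = M⊆Out m

    Act-Ω : ∀ {c} → Act ΩM c → Act X c ⊎ Σ L λ a → M a × c ≡ a ▷
    Act-Ω (inj₁ i) = inj₁ (inj₁ (proj₁ (In-Ω i)))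
    Act-Ω (inj₂ (inj₁ o)) = inj₁ (inj₂ (inj₁ (Out-Ω o)))
    Act-Ω (inj₂ (inj₂ (inj₁ (i , _)))) = inj₁ (inj₂ (inj₂ i))
    Act-Ω (inj₂ (inj₂ (inj₂ (inj₁ ()))))
    Act-Ω (inj₂ (inj₂ (inj₂ (inj₂ (inj₁ ((i , _) , _)))))) = inj₁ (inj₁ i)
    Act-Ω (inj₂ (inj₂ (inj₂ (inj₂ (inj₂ (renamed , _)))))) = inj₂ renamed

    In-Ω-intro : ∀ {c} → In X c → ¬ M c → In ΩM c
    In-Ω-intro i ¬m = inj₁ (i , ¬m) , ¬Shared-RQ (inj₁ i)

    Out-Ω-intro : ∀ {c} → M c → Out ΩM c
    Out-Ω-intro m = inj₂ m , ¬Shared-RQ (inj₂ (inj₁ (M⊆Out m)))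

    Ω-local : ∀ {s c s' q} → ¬ M c → (X ⟶[ s ] c) s' → (ΩM ⟶[ (s , q) ] c) (s' , q)
    Ω-local ¬m t = stepA (¬Shared-RQ (trans-act _ _ _ t)) (keep ¬m t)

    Ω-send : ∀ {s a s' q} → M a → (X ⟶[ s ] a) s' → (ΩM ⟶[ (s , q) ] (a ▷)) (s' , q ++ [ a ])
    Ω-send m t = sync (renamed-shared m) (ren m t) (enq m)

    Ω-int-steps : ∀ {s s' q} → Steps X (Int X) s s' → Steps ΩM (Int ΩM) (s , q) (s' , q)
    Ω-int-steps {q = q} = gmap (_, q) λ (c , i , t) →
      let ¬m = λ m → out-int c (M⊆Out m) i in c , inj₁ (i , ¬m) , Ω-local ¬m t

    data ΩStep : State X × List L → L → State X × List L → Set where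
      local   : ∀ {s s' q c} → ¬ M c → (X ⟶[ s ] c) s' → ΩStep (s , q) c (s' , q)
      send    : ∀ {s s' q a} → M a → (X ⟶[ s ] a) s' → ΩStep (s , q) (a ▷) (s' , q ++ [ a ])
      deliver : ∀ {s q a} → M a → ΩStep (s , a ∷ q) a (s , q)

    -- The label a ▷ of a renamed send cannot be unified with the label of
    -- an enqueue directly; injectivity of _▷ does it.
    enqueued : ∀ {s a s' q c q'} → M a → (X ⟶[ s ] a) s' → QStep M q c q' → c ≡ a ▷ →
      ΩStep (s , q) c (s' , q')
    enqueued m t (enq _) eq with ▷-injective eq
    ... | refl = send m t
    enqueued m _ (deq m') refl = ⊥-elim (fresh m (inj₂ (inj₁ (M⊆Out m'))))

    Ω-view : ∀ {p c p'} → (ΩM ⟶[ p ] c) p' → ΩStep p c p'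
    Ω-view (stepA _ (keep ¬m t)) = local ¬m t
    Ω-view (stepA ¬sh (ren m _)) = ⊥-elim (¬sh (renamed-shared m))
    Ω-view (stepB _ (deq m)) = deliver m
    Ω-view (stepB ¬sh (enq m)) = ⊥-elim (¬sh (renamed-shared m))
    Ω-view (sync _ (keep _ t) (enq m)) = ⊥-elim (fresh m (trans-act _ _ _ t))
    Ω-view (sync _ (keep ¬m _) (deq m)) = ⊥-elim (¬m m)
    Ω-view (sync _ (ren m t) qs) = enqueued m t qs refl

    All-step : ∀ {s q c s' q'} → All M q → (ΩM ⟶[ (s , q) ] c) (s' , q') → All M q'
    All-step ms t with Ω-view t
    ... | local _ _ = ms
    ... | send m _ = ∷ʳ⁺ ms m
    All-step (_ ∷ ms) _ | deliver _ = ms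

    data Dequeue (a : L) : State X × List L → State X × List L → Set where
      dequeue : ∀ {s q} → Dequeue a (s , a ∷ q) (s , q)

    data Receipt (a : L) : State X × List L → State X × List L → Set where
      receipt : ∀ {s s' q} → (X ⟶[ s ] a) s' → Receipt a (s , q) (s' , q)

    output-dequeues : ∀ {p a p'} → M a → (ΩM ⟶[ p ] a) p' → Dequeue a p p'
    output-dequeues m t with Ω-view t
    ... | local ¬m _ = ⊥-elim (¬m m)
    ... | send m' _ = ⊥-elim (fresh m' (inj₂ (inj₁ (M⊆Out m))))
    ... | deliver _ = dequeue

    input-receives : ∀ {p a p'} → In X a → (ΩM ⟶[ p ] a) p' → Receipt a p p'
    input-receives i t with Ω-view t
    ... | local _ u = receipt u
    ... | send m _ = ⊥-elim (fresh m (inj₁ i))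
    ... | deliver m = ⊥-elim (in-out _ i (M⊆Out m))

  module Pair (▷-injective : Injective _≡_ _≡_ _▷) (X Y : IOTS L) (wfX : WellFormed X) (wfY : WellFormed Y)
              (fresh : ∀ a → Shared X Y a → ¬ Act X (a ▷) × ¬ Act Y (a ▷)) where
    freshX : ∀ {a} → OutAB X Y a → ¬ Act X (a ▷)
    freshX (o , i) = proj₁ (fresh _ (inj₂ (i , o)))

    freshY : ∀ {a} → OutAB Y X a → ¬ Act Y (a ▷)
    freshY (o , i) = proj₂ (fresh _ (inj₁ (i , o)))

    module QX = Queued ▷-injective X wfX (OutAB X Y) proj₁ freshX
    module QY = Queued ▷-injective Y wfY (OutAB Y X) proj₁ freshY

    ΩX ΩY : IOTS L
    ΩX = ΩA X Y
    ΩY = ΩA Y X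

    OutAB-back : ∀ {a} → OutAB X Y a → ¬ OutAB Y X a
    OutAB-back (_ , i) (o , _) = WellFormed.in-out wfY _ i o

    OutAB-forth : ∀ {a} → OutAB Y X a → ¬ OutAB X Y a
    OutAB-forth (_ , i) (o , _) = WellFormed.in-out wfX _ i o

    Shared-Ω : ∀ {c} → Shared X Y c → Shared ΩX ΩY c
    Shared-Ω (inj₁ (i , o)) = inj₁ (QX.In-Ω-intro i (OutAB-forth (o , i)) , QY.Out-Ω-intro (o , i))
    Shared-Ω (inj₂ (i , o)) = inj₂ (QY.In-Ω-intro i (OutAB-back (o , i)) , QX.Out-Ω-intro (o , i))

    ¬Shared-Ω : ∀ {c} → ¬ Shared ΩX ΩY c → ¬ Shared X Y c
    ¬Shared-Ω ¬sh = ¬sh ∘ Shared-Ω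

    ¬Shared-renamed : ∀ {x} → OutAB X Y x → ¬ Shared ΩX ΩY (x ▷)
    ¬Shared-renamed m (inj₁ (i , _)) = freshX m (inj₁ (proj₁ (QX.In-Ω i)))
    ¬Shared-renamed m (inj₂ (_ , o)) = freshX m (inj₂ (inj₁ (QX.Out-Ω o)))

    OutAB-Ω : ∀ {c} → Out ΩX c → In ΩY c → OutAB X Y c
    OutAB-Ω o i = QX.Out-Ω o , proj₁ (QY.In-Ω i)

    Ω-composable : Composable X Y → Composable ΩX ΩY
    Ω-composable comp c actX actY with QX.Act-Ω actX | QY.Act-Ω actY
    ... | inj₁ x | inj₁ y = Shared-Ω (comp c x y)
    ... | inj₁ x | inj₂ (_ , n , refl) = ⊥-elim (proj₁ (fresh _ (inj₁ (proj₂ n , proj₁ n))) x)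
    ... | inj₂ (_ , m , refl) | inj₁ y = ⊥-elim (proj₂ (fresh _ (inj₂ (proj₂ m , proj₁ m))) y)
    ... | inj₂ (_ , m , refl) | inj₂ (_ , n , eq) with ▷-injective eq
    ...   | refl = ⊥-elim (OutAB-back m n)

    OneSided-local : ∀ {sX qX sY qY c sX' qX'} → NoCrossing X Y sX qY → All (OutAB Y X) qY →
      ¬ Shared ΩX ΩY c → (ΩX ⟶[ (sX , qX) ] c) (sX' , qX') →
      OneSided X Y sX qX sY qY → OneSided X Y sX' qX' sY qY
    OneSided-local blocked sends ¬sh t os with QX.Ω-view t | os
    ... | QX.local _ u | inj₁ (e , a) =
      inj₁ (e , Ahead-local a u (WellFormed.trans-act wfX _ _ _ u , ¬Shared-Ω ¬sh))
    ... | QX.local _ u | inj₂ (e , a) = inj₂ (e , Ahead-partner-local a u (¬Shared-Ω ¬sh ∘ ⊎-swap))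
    ... | QX.send _ u | inj₁ (e , a) = inj₁ (e , Ahead-send a u)
    ... | QX.send m u | inj₂ (refl , a) = inj₁ (Ahead-switch blocked sends a m u)
    ... | QX.deliver (o , i) | _ = ⊥-elim (¬sh (Shared-Ω (inj₂ (i , o))))

    OneSided-transmit : ∀ {sX qX sY qY c sX' qX' sY' qY'} → OutAB X Y c →
      (ΩX ⟶[ (sX , qX) ] c) (sX' , qX') → (ΩY ⟶[ (sY , qY) ] c) (sY' , qY') →
      OneSided X Y sX qX sY qY → OneSided X Y sX' qX' sY' qY'
    OneSided-transmit m tX tY os with QX.output-dequeues m tX | QY.input-receives (proj₂ m) tY | os
    ... | QX.dequeue | QY.receipt u | inj₁ (e , a) = inj₁ (e , Ahead-partner-receive a m u)
    ... | QX.dequeue | _ | inj₂ (() , _)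

    pending-send : ∀ {sX qX sY qY a pX'} → OneSided X Y sX qX sY qY → OutAB X Y a →
      (ΩX ⟶[ (sX , qX) ] a) pX' → ∃₂ λ s̄ s̄' → Reach (X ⊗ Y) (s̄ , sY) × (X ⟶[ s̄ ] a) s̄'
    pending-send os m t with QX.output-dequeues m t | os
    ... | QX.dequeue | inj₁ (_ , a) = Ahead-head a
    ... | QX.dequeue | inj₂ (() , _)

    strong-side : ∀ {sX qX sY qY} → OneSided X Y sX qX sY qY →
      (∀ {s̄} → Reach (X ⊗ Y) (s̄ , sY) → StrongSide X Y s̄ sY) → StrongSide ΩX ΩY (sX , qX) (sY , qY)
    strong-side {qY = qY} os compatible a _ o i t =
      let m = OutAB-Ω o i
          _ , s̄' , r , u = pending-send os m t
          sY' , v = compatible r a s̄' (proj₁ m) (proj₂ m) u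
      in (sY' , qY) , QY.Ω-local (OutAB-back m) v

    weak-side : ∀ {sX qX sY qY} → OneSided X Y sX qX sY qY →
      (∀ {s̄} → Reach (X ⊗ Y) (s̄ , sY) → WeakSide X Y s̄ sY) → WeakSide ΩX ΩY (sX , qX) (sY , qY)
    weak-side {qY = qY} os compatible a _ o i t =
      let m = OutAB-Ω o i
          _ , s̄' , r , u = pending-send os m t
          s̄Y , sY' , int , v = compatible r a s̄' (proj₁ m) (proj₂ m) u
      in (s̄Y , qY) , (sY' , qY) , QY.Ω-int-steps int , QY.Ω-local (OutAB-back m) v

  module Composition (▷-injective : Injective _≡_ _≡_ _▷) (A B : IOTS L)
                     (wfA : WellFormed A) (wfB : WellFormed B) (ac : AsyncComposable A B) where
    module PA = Pair ▷-injective A B wfA wfB (proj₂ ac)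
    module PB = Pair ▷-injective B A wfB wfA (λ a → ×-swap ∘ proj₂ ac a ∘ ⊎-swap)

    QueuesOutgoing : State (A ⊗as B) → Set
    QueuesOutgoing ((_ , qA) , (_ , qB)) = All (OutAB A B) qA × All (OutAB B A) qB

    queues-outgoing : ∀ {p} → Reach (A ⊗as B) p → QueuesOutgoing p
    queues-outgoing = Reach-invariant (A ⊗as B) QueuesOutgoing ([] , []) step
      where
      step : ∀ {p c p'} → Reach (A ⊗as B) p → QueuesOutgoing p → ((A ⊗as B) ⟶[ p ] c) p' → QueuesOutgoing p'
      step _ (ma , mb) (stepA _ t) = PA.QX.All-step ma t , mb
      step _ (ma , mb) (stepB _ t) = ma , PB.QX.All-step mb t
      step _ (ma , mb) (sync _ tA tB) = PA.QX.All-step ma tA , PB.QX.All-step mb tB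

    -- Under half-duplex, sending x would reach a state with both queues nonempty.
    no-crossing : HalfDuplex A B ⊎ NoMixedSends A B → ∀ {sA qA sB qB} →
      Reach (A ⊗as B) ((sA , qA) , (sB , qB)) → NoCrossing A B sA qB × NoCrossing B A sB qA
    no-crossing (inj₁ hd) {qA = qA} {qB = qB} r =
      (λ qB≢[] _ _ _ u m → [ (λ ()) ∘ ++-conicalʳ qA _ , qB≢[] ]′
         (hd _ _ _ _ (snoc r (_ , stepA (PA.¬Shared-renamed m) (PA.QX.Ω-send m u))))) ,
      (λ qA≢[] _ _ _ u m → [ qA≢[] , (λ ()) ∘ ++-conicalʳ qB _ ]′
         (hd _ _ _ _ (snoc r (_ , stepB (PB.¬Shared-renamed m ∘ ⊎-swap) (PB.QX.Ω-send m u)))))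
    no-crossing (inj₂ nms) r =
      (λ _ r̄ t n u m → [ (λ k → k m) , (λ k → k n) ]′ (nms _ _ r̄ _ _ _ _ u t)) ,
      (λ _ r̄ t n u m → [ (λ k → k n) , (λ k → k m) ]′ (nms _ _ (Reach-swap r̄) _ _ _ _ t u))

    OneSidedAt : State (A ⊗as B) → Set
    OneSidedAt ((sA , qA) , (sB , qB)) = OneSided A B sA qA sB qB

    one-sided-step : HalfDuplex A B ⊎ NoMixedSends A B → ∀ {p c p'} →
      Reach (A ⊗as B) p → OneSidedAt p → ((A ⊗as B) ⟶[ p ] c) p' → OneSidedAt p'
    one-sided-step h r os (stepA ¬sh t) =
      PA.OneSided-local (proj₁ (no-crossing h r)) (proj₂ (queues-outgoing r)) ¬sh t os
    one-sided-step h r os (stepB ¬sh t) = ⊎-swap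
      (PB.OneSided-local (proj₂ (no-crossing h r)) (proj₁ (queues-outgoing r)) (¬sh ∘ ⊎-swap) t (⊎-swap os))
    one-sided-step h r os (sync (inj₂ (i , o)) tA tB) = PA.OneSided-transmit (PA.OutAB-Ω o i) tA tB os
    one-sided-step h r os (sync (inj₁ (i , o)) tA tB) =
      ⊎-swap (PB.OneSided-transmit (PB.OutAB-Ω o i) tB tA (⊎-swap os))

    one-sided : PropertyP A B ⊎ HalfDuplex A B ⊎ NoMixedSends A B → ∀ {sA qA sB qB} →
      Reach (A ⊗as B) ((sA , qA) , (sB , qB)) → OneSided A B sA qA sB qB
    one-sided (inj₁ P) r with P _ _ _ _ r
    ... | inj₁ (refl , refl , r') = inj₁ (refl , ahead r' [])
    ... | inj₂ (inj₁ (_ , refl , _ , r' , ch)) = inj₁ (refl , ahead r' ch)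
    ... | inj₂ (inj₂ (refl , _ , _ , r' , ch)) = inj₂ (refl , ahead (Reach-swap r') ch)
    one-sided (inj₂ h) = Reach-invariant (A ⊗as B) OneSidedAt (inj₁ (refl , ahead ε [])) (one-sided-step h)

theorem4p3 : {L : Set} (_▷ : L → L) → Injective _≡_ _≡_ _▷ →
    (A B : IOTS L) → WellFormed A → WellFormed B →
    Async.AsyncComposable _▷ A B →
    (AsyncProps.PropertyP _▷ A B ⊎ AsyncProps.HalfDuplex _▷ A B ⊎ NoMixedSends A B) →
    (StrongSyncCompatible A B → AsyncProps.StrongAsyncCompatible _▷ A B) ×
    (WeakSyncCompatible A B → AsyncProps.WeakAsyncCompatible _▷ A B)
theorem4p3 _▷ ▷-injective A B wfA wfB ac hyp =
  (λ (comp , compatible) → PA.Ω-composable comp , λ _ _ r → let os = one-sided hyp r in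
     PA.strong-side os (λ r' → proj₁ (compatible _ _ r')) ,
     PB.strong-side (⊎-swap os) (λ r' → proj₂ (compatible _ _ (Reach-swap _▷ r')))) ,
  (λ (comp , compatible) → PA.Ω-composable comp , λ _ _ r → let os = one-sided hyp r in
     PA.weak-side os (λ r' → proj₁ (compatible _ _ r')) ,
     PB.weak-side (⊎-swap os) (λ r' → proj₂ (compatible _ _ (Reach-swap _▷ r'))))
  where open Composition _▷ ▷-injective A B wfA wfB ac
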